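{- Let $I=(i_1,\ldots,i_r)$ be a composition of $n$, and let $D_{\le I}$ be the set of $\sigma\in\mathfrak S_n$ whose descent set $\{j:\sigma(j)>\sigma(j+1)\}$ is contained in $\{i_1,i_1+i_2,\ldots,i_1+\cdots+i_{r-1}\}$. Then, in the free associative algebra on the noncommuting letters $a_0,a_1,a_2,\ldots$, $$\sum_{\sigma\in D_{\le I}} a_{\operatorname{Ic}(\sigma^{ -1})}=\sum_{\sigma\in \operatorname{id}_{i_1}\Cup\cdots\Cup\operatorname{id}_{i_r}} a_{\operatorname{Ic}(\sigma)}=S_{i_1}(A_{i_2+\cdots+i_r})\,S_{i_2}(A_{i_3+\cdots+i_r})\cdots S_{i_{r-1}}(A_{i_r})\,S_{i_r}(A_0).$$
   Context: Permutations are words $\sigma=\sigma(1)\cdots\sigma(n)$. The set $\operatorname{id}_{i_1}\Cup\cdots\Cup\operatorname{id}_{i_r}$ is the set of $\sigma\in\mathfrak S_n$ such that for each $p$ the letters $s_{p-1}+1,\ldots,s_p$ (with $s_p=i_1+\cdots+i_p$, $s_0=0$) appear in $\sigma$ from left to right in increasing order; it is the set of inverses of elements of $D_{\le I}$. For a sequence $c=(c_1,\ldots,c_n)$ of nonnegative integers, $a_c$ denotes the (noncommutative) word $a_{c_1}a_{c_2}\cdots a_{c_n}$. For $m\ge0$, $A_m$ is the ordered alphabet $a_0<a_1<\cdots<a_m$, and $S_k(A_m)$ is the sum of all nondecreasing words of length $k$ over $A_m$ (i.e. all $a_{j_1}\cdots a_{j_k}$ with $0\le j_1\le\cdots\le j_k\le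 m$). Invcode: $\operatorname{Ic}(\sigma)=(a_1,\ldots,a_n)$ where the $i$-th entry is the number of values greater than $i$ to the left of $i$ in $\sigma$. -}

module Defs where

open import Data.Nat using (ℕ; zero; suc; _+_; _<_; _≤_; _≟_; _<?_; _≤?_; _≡ᵇ_)
open import Data.Bool using (if_then_else_)
open import Data.List using (List; []; _∷_; [_]; map; filter; concatMap; _++_; length; upTo; takeWhile)
open import Data.Nat.ListAction using (sum)
open import Data.List.Relation.Unary.All using (All; all?)
open import Data.List.Relation.Unary.Linked using (Linked; linked?)
open import Data.List.Membership.DecPropositional _≟_ using (_∈_; _∈?_)
open import Data.List.Properties using (≡-dec)
open import Relation.Binary.PropositionalEquality using (_≡_)
open import Relation.Nullary using (Dec; yes; no; ¬_; ¬?)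
open import Relation.Unary using (Decidable)

-- Words/permutations are lists of naturals.  A permutation σ ∈ 𝔖ₙ is the word
-- σ(1)⋯σ(n) over the letters 1..n.

range : ℕ → List ℕ
range n = map suc (upTo n)

words : ℕ → List ℕ → List (List ℕ)
words zero    alph = [ [] ]
words (suc k) alph = concatMap (λ a → map (a ∷_) (words k alph)) alph

-- a word of length n over {1..n} is a permutation iff every letter occurs
IsPerm : ℕ → List ℕ → Set
IsPerm n w = All (_∈ w) (range n)

isPerm? : (n : ℕ) → Decidable (IsPerm n)
isPerm? n w = all? (_∈? w) (range n)

Sym : ℕ → List (List ℕ)
Sym n = filter (isPerm? n) (words n (range n))

descentsFrom : ℕ → List ℕ → List ℕ
descentsFrom k []      = []
descentsFrom k (x ∷ r) = go k x r
  where
  go : ℕ → ℕ → List ℕ → List ℕ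
  go k x []      = []
  go k x (y ∷ r) with y <? x
  ... | yes _ = k ∷ go (suc k) y r
  ... | no  _ = go (suc k) y r

descents : List ℕ → List ℕ
descents σ = descentsFrom 1 σ

cutsFrom : ℕ → List ℕ → List ℕ
cutsFrom acc []            = []
cutsFrom acc (i ∷ [])      = []
cutsFrom acc (i ∷ j ∷ r)   = (acc + i) ∷ cutsFrom (acc + i) (j ∷ r)

cuts : List ℕ → List ℕ
cuts I = cutsFrom 0 I

InD≤ : List ℕ → List ℕ → Set
InD≤ I σ = All (_∈ cuts I) (descents σ)

inD≤? : (I : List ℕ) → Decidable (InD≤ I)
inD≤? I σ = all? (_∈? cuts I) (descents σ)

posOf : ℕ → List ℕ → ℕ
posOf v []       = 0
posOf v (x ∷ xs) = if v ≡ᵇ x then 1 else suc (posOf v xs)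

inv : List ℕ → List ℕ
inv σ = map (λ v → posOf v σ) (range (length σ))

Ic : List ℕ → List ℕ
Ic σ = map (λ i → length (filter (i <?_) (takeWhile (λ x → ¬? (x ≟ i)) σ)))
           (range (length σ))

blocksFrom : ℕ → List ℕ → List (List ℕ)
blocksFrom acc []      = []
blocksFrom acc (i ∷ r) = map (acc +_) (range i) ∷ blocksFrom (acc + i) r

blocks : List ℕ → List (List ℕ)
blocks I = blocksFrom 0 I

-- σ ∈ id_{i₁} ⋒ ⋯ ⋒ id_{i_r}: letters of each block appear in σ in increasing
-- order, i.e. the subword of σ on the block is the block itself
InShuffle : List ℕ → List ℕ → Set
InShuffle I σ = All (λ b → filter (_∈? b) σ ≡ b) (blocks I)

inShuffle? : (I : List ℕ) → Decidable (InShuffle I)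
inShuffle? I σ = all? (λ b → ≡-dec _≟_ (filter (_∈? b) σ) b) (blocks I)

-- Elements of the free algebra ℕ⟨a₀,a₁,…⟩ with nonnegative integer coefficients
-- are represented as lists of words (a word a_{c₁}⋯a_{c_k} as the list c₁…c_k);
-- two such sums are equal iff the lists are permutations of each other (↭).

_⊗_ : List (List ℕ) → List (List ℕ) → List (List ℕ)
xs ⊗ ys = concatMap (λ u → map (u ++_) ys) xs

S : ℕ → ℕ → List (List ℕ)
S k m = filter (linked? _≤?_) (words k (upTo (suc m)))

rhsProd : List ℕ → List (List ℕ)
rhsProd []      = [ [] ]
rhsProd (i ∷ r) = S i (sum r) ⊗ rhsProd r

-- A permutation σ has all its descents at cuts of I iff in σ⁻¹ every non-cut j appears before
-- j + 1, which is exactly the condition for σ⁻¹ to be a shuffle of the blocks id_{i₁}, …, id_{i_r};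
-- as σ ↦ σ⁻¹ is an involution, this gives the first equality.
-- For the second, let c = Ic τ. Rebuilding τ from its largest letter down, the letter j is
-- inserted right after c_j larger letters, so τ is determined by c, every c with c_j ≤ n − j
-- arises, and j comes before j + 1 in τ iff c_j ≤ c_{j+1}. Hence Ic maps the shuffles bijectively
-- onto the codes with c_j ≤ n − j that weakly increase inside each block. Cut into blocks, such a
-- code has as p-th block a weakly increasing word whose last letter is at most
-- n − (i₁ + ⋯ + i_p) = i_{p+1} + ⋯ + i_r, i.e. a term of S_{i_p}(A_{i_{p+1}+⋯+i_r}).
-- All lists involved are duplicate-free, so comparing the sums amounts to comparing members.

module Submission where

open import Defs
open import Data.Nat using (ℕ; zero; suc; _+_; _∸_; _<_; _≤_; _≟_; _<?_; _≤?_; _≡ᵇ_; z≤n; s≤s)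
open import Data.Nat.Properties
open import Data.Bool using (true; false; T)
open import Data.Unit using (⊤; tt)
open import Data.List
  using ( List; []; _∷_; map; filter; concatMap; _++_; length; upTo; applyUpTo; takeWhile; deduplicate
        ; cartesianProductWith)
open import Data.List.Properties
  using ( ∷-injective; ++-cancelˡ; length-++; length-map; length-filter; length-deduplicate
        ; filter-notAll; filter-accept; filter-reject; filter-all; filter-none
        ; map-cong; map-cong-local; map-∘; map-upTo)
open import Data.Nat.ListAction using (sum)
open import Data.List.Relation.Unary.All as All using (All; []; _∷_)
open import Data.List.Relation.Unary.All.Properties using (¬Any⇒All¬)
import Data.List.Relation.Unary.All.Properties as AllP
open import Data.List.Relation.Unary.Any as Any using (here; there)
open import Data.List.Relation.Unary.Unique.Propositional using (Unique)
open import Data.List.Relation.Unary.AllPairs using ([]; _∷_)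
import Data.List.Relation.Unary.Unique.Propositional.Properties as UniqueP
open import Data.List.Relation.Unary.Linked using (Linked; []; [-]; _∷_; linked?)
open import Data.List.Membership.Propositional using (_∈_; _∉_)
open import Data.List.Membership.Propositional.Properties
open import Data.List.Membership.Propositional.Properties.WithK using (unique∧set⇒bag)
open import Data.List.Membership.DecPropositional _≟_ using (_∈?_)
open import Data.List.Relation.Binary.BagAndSetEquality using (∼bag⇒↭)
open import Data.List.Relation.Binary.Permutation.Propositional
  using (_↭_; ↭-refl; ↭-sym; ↭-trans; ↭-prep; ↭-swap)
import Data.List.Relation.Binary.Permutation.Propositional.Properties as ↭P
open import Data.List.Relation.Binary.Disjoint.Propositional using (Disjoint)
open import Data.Product using (_×_; _,_; proj₁; proj₂; ∃-syntax)
open import Data.Sum using (_⊎_; inj₁; inj₂)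
open import Data.Empty using (⊥-elim)
open import Function using (_∘_; mk⇔; case_of_)
open import Relation.Binary.PropositionalEquality
  using (_≡_; _≢_; refl; sym; trans; cong; cong₂; subst; subst₂; module ≡-Reasoning)
open import Relation.Nullary using (Dec; yes; no; ¬_; ¬?)
open import Relation.Binary.Definitions using (tri<; tri≈; tri>)

module _ {A : Set} where

  unique∧set⇒↭ : {xs ys : List A} → Unique xs → Unique ys →
    (∀ {x} → x ∈ xs → x ∈ ys) → (∀ {x} → x ∈ ys → x ∈ xs) → xs ↭ ys
  unique∧set⇒↭ uxs uys xs⊆ys ys⊆xs = ∼bag⇒↭ (unique∧set⇒bag uxs uys (mk⇔ xs⊆ys ys⊆xs))

  ∈-∷⁻ : ∀ {x y : A} {xs} → x ∈ y ∷ xs → x ≢ y → x ∈ xs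
  ∈-∷⁻ (here x≡y) x≢y = ⊥-elim (x≢y x≡y)
  ∈-∷⁻ (there x∈xs) _ = x∈xs

  Unique-⊆⇒length-≤ : {xs ys : List A} → Unique xs → (∀ {x} → x ∈ xs → x ∈ ys) →
    length xs ≤ length ys
  Unique-⊆⇒length-≤ {[]} _ _ = z≤n
  Unique-⊆⇒length-≤ {x ∷ xs} (x∉xs ∷ uxs) xs⊆ys with ∈-∃++ (xs⊆ys (here refl))
  ... | ys₁ , ys₂ , refl = begin
    suc (length xs)               ≤⟨ s≤s (Unique-⊆⇒length-≤ uxs xs⊆ys₁₂) ⟩
    suc (length (ys₁ ++ ys₂))     ≡⟨ cong suc (length-++ ys₁) ⟩
    suc (length ys₁ + length ys₂) ≡⟨ sym (+-suc (length ys₁) (length ys₂)) ⟩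
    length ys₁ + length (x ∷ ys₂) ≡⟨ sym (length-++ ys₁) ⟩
    length (ys₁ ++ x ∷ ys₂)       ∎
    where
    open ≤-Reasoning
    delete : ∀ {y} zs → y ∈ zs ++ x ∷ ys₂ → y ≢ x → y ∈ zs ++ ys₂
    delete []       y∈ y≢x = ∈-∷⁻ y∈ y≢x
    delete (z ∷ zs) (here y≡z) _ = here y≡z
    delete (z ∷ zs) (there y∈) y≢x = there (delete zs y∈ y≢x)
    xs⊆ys₁₂ : ∀ {y} → y ∈ xs → y ∈ ys₁ ++ ys₂
    xs⊆ys₁₂ y∈xs = delete ys₁ (xs⊆ys (there y∈xs)) (λ y≡x → All.lookup x∉xs y∈xs (sym y≡x))

  map⁺-injectiveOn : ∀ {B : Set} (f : A → B) {xs} →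
    (∀ {x y} → x ∈ xs → y ∈ xs → f x ≡ f y → x ≡ y) → Unique xs → Unique (map f xs)
  map⁺-injectiveOn f {[]} _ [] = []
  map⁺-injectiveOn f {x ∷ xs} inj (x∉xs ∷ uxs) =
    AllP.map⁺ (All.tabulate (λ y∈xs fx≡fy → All.lookup x∉xs y∈xs (inj (here refl) (there y∈xs) fx≡fy)))
    ∷ map⁺-injectiveOn f (λ x∈ y∈ → inj (there x∈) (there y∈)) uxs

length-≤-deduplicate⇒Unique : ∀ xs → length xs ≤ length (deduplicate _≟_ xs) → Unique xs
length-≤-deduplicate⇒Unique [] _ = []
length-≤-deduplicate⇒Unique (x ∷ xs) (s≤s len≤) =
  ¬Any⇒All¬ xs (λ x∈xs → <-irrefl refl (≤-trans (s≤s len≤) (dedup-short x∈xs)))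
  ∷ length-≤-deduplicate⇒Unique xs (≤-trans len≤ (length-filter (¬? ∘ (x ≟_)) (deduplicate _≟_ xs)))
  where
  dedup-short : x ∈ xs → length (filter (¬? ∘ (x ≟_)) (deduplicate _≟_ xs)) < length xs
  dedup-short x∈xs = ≤-trans
    (filter-notAll (¬? ∘ (x ≟_)) _ (Any.map (λ x≡ x≢ → x≢ x≡) (∈-deduplicate⁺ _≟_ x∈xs)))
    (length-deduplicate _≟_ xs)

concatMap-map≡cartesianProductWith : ∀ {A B C : Set} (f : A → B → C) xs ys →
  concatMap (λ x → map (f x) ys) xs ≡ cartesianProductWith f xs ys
concatMap-map≡cartesianProductWith f [] ys = refl
concatMap-map≡cartesianProductWith f (x ∷ xs) ys =
  cong (map (f x) ys ++_) (concatMap-map≡cartesianProductWith f xs ys)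

splitAt-length : ∀ i (w : List ℕ) → i ≤ length w → ∃[ u ] ∃[ v ] (w ≡ u ++ v × length u ≡ i)
splitAt-length zero    w       _        = [] , w , refl , refl
splitAt-length (suc i) (x ∷ w) (s≤s i≤) with u , v , refl , refl ← splitAt-length i w i≤ =
  x ∷ u , v , refl , refl

++-injectiveˡ-sameLength : ∀ (u u′ : List ℕ) {v v′} →
  length u ≡ length u′ → u ++ v ≡ u′ ++ v′ → u ≡ u′
++-injectiveˡ-sameLength []      []       _   _  = refl
++-injectiveˡ-sameLength (a ∷ u) (b ∷ u′) len eq with ∷-injective eq
... | a≡b , eq′ = cong₂ _∷_ a≡b (++-injectiveˡ-sameLength u u′ (suc-injective len) eq′)

data Offset (i : ℕ) : ℕ → Set where
  before : ∀ {j} → j < i → Offset i j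
  pivot  : Offset i i
  after  : ∀ k → 0 < k → Offset i (i + k)

offset : ∀ i j → Offset i j
offset i j with <-cmp j i
... | tri< j<i _ _  = before j<i
... | tri≈ _ refl _ = pivot
... | tri> _ _ i<j  = subst (Offset i) (m+[n∸m]≡n (<⇒≤ i<j)) (after (j ∸ i) (m<n⇒0<n∸m i<j))

posOf-here : ∀ v xs → posOf v (v ∷ xs) ≡ 1
posOf-here v xs with v ≡ᵇ v in v≡ᵇv
... | true  = refl
... | false = ⊥-elim (subst T v≡ᵇv (≡⇒≡ᵇ v v refl))

posOf-there : ∀ {v x} xs → v ≢ x → posOf v (x ∷ xs) ≡ suc (posOf v xs)
posOf-there {v} {x} xs v≢x with v ≡ᵇ x in v≡ᵇx
... | false = refl
... | true  = ⊥-elim (v≢x (≡ᵇ⇒≡ v x (subst T (sym v≡ᵇx) tt)))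

interval : ℕ → ℕ → List ℕ
interval a zero    = []
interval a (suc k) = a ∷ interval (suc a) k

∈-interval⁻ : ∀ {a k x} → x ∈ interval a k → a ≤ x × x < a + k
∈-interval⁻ {a} {suc k} (here refl) = ≤-refl , m<m+n a (s≤s z≤n)
∈-interval⁻ {a} {suc k} {x} (there x∈) with ∈-interval⁻ x∈
... | a<x , x<a+1+k = <⇒≤ a<x , subst (x <_) (sym (+-suc a k)) x<a+1+k

∈-interval⁺ : ∀ {a k x} → a ≤ x → x < a + k → x ∈ interval a k
∈-interval⁺ {a} {zero} a≤x x<a+0 =
  ⊥-elim (<-irrefl refl (<-≤-trans x<a+0 (subst (_≤ _) (sym (+-identityʳ a)) a≤x)))
∈-interval⁺ {a} {suc k} {x} a≤x x<a+1+k with a ≟ x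
... | yes refl = here refl
... | no a≢x   = there (∈-interval⁺ (≤∧≢⇒< a≤x a≢x) (subst (x <_) (+-suc a k) x<a+1+k))

unique-interval : ∀ a k → Unique (interval a k)
unique-interval a zero    = []
unique-interval a (suc k) =
  ¬Any⇒All¬ _ (λ a∈ → <-irrefl refl (proj₁ (∈-interval⁻ a∈))) ∷ unique-interval (suc a) k

length-interval : ∀ a k → length (interval a k) ≡ k
length-interval a zero    = refl
length-interval a (suc k) = cong suc (length-interval (suc a) k)

posOf-interval : ∀ {a k x} → x ∈ interval a k → posOf x (interval a k) ≡ suc (x ∸ a)
posOf-interval {a} {suc k} {x} x∈ with x ≟ a
... | yes refl = trans (posOf-here x (interval (suc x) k)) (cong suc (sym (n∸n≡0 x)))
... | no x≢a   = trans (posOf-there (interval (suc a) k) x≢a)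
  (cong suc (trans (posOf-interval x∈′) (sym (+-∸-assoc 1 (proj₁ (∈-interval⁻ x∈′))))))
  where
  x∈′ : x ∈ interval (suc a) k
  x∈′ = ∈-∷⁻ x∈ x≢a

map-+-interval : ∀ c a k → map (c +_) (interval a k) ≡ interval (c + a) k
map-+-interval c a zero    = refl
map-+-interval c a (suc k) =
  cong (c + a ∷_) (trans (map-+-interval c (suc a) k) (cong (λ b → interval b k) (+-suc c a)))

applyUpTo-+≡interval : ∀ a k → applyUpTo (a +_) k ≡ interval a k
applyUpTo-+≡interval a zero    = refl
applyUpTo-+≡interval a (suc k) = cong₂ _∷_ (+-identityʳ a) (begin
  applyUpTo (λ x → a + suc x) k  ≡⟨ sym (map-upTo _ k) ⟩
  map (λ x → a + suc x) (upTo k) ≡⟨ map-cong (+-suc a) (upTo k) ⟩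
  map (suc a +_) (upTo k)        ≡⟨ map-upTo _ k ⟩
  applyUpTo (suc a +_) k         ≡⟨ applyUpTo-+≡interval (suc a) k ⟩
  interval (suc a) k             ∎)
  where open ≡-Reasoning

range≡interval : ∀ n → range n ≡ interval 1 n
range≡interval n = trans (map-upTo suc n) (applyUpTo-+≡interval 1 n)

∈-range⁻ : ∀ {n x} → x ∈ range n → 0 < x × x ≤ n
∈-range⁻ {n} x∈ with ∈-interval⁻ (subst (_ ∈_) (range≡interval n) x∈)
... | 0<x , s≤s x≤n = 0<x , x≤n

∈-range⁺ : ∀ {n x} → 0 < x → x ≤ n → x ∈ range n
∈-range⁺ {n} 0<x x≤n = subst (_ ∈_) (sym (range≡interval n)) (∈-interval⁺ 0<x (s≤s x≤n))

length-range : ∀ n → length (range n) ≡ n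
length-range n = trans (cong length (range≡interval n)) (length-interval 1 n)

unique-range : ∀ n → Unique (range n)
unique-range n = subst Unique (sym (range≡interval n)) (unique-interval 1 n)

words-suc : ∀ k alph → words (suc k) alph ≡ cartesianProductWith _∷_ alph (words k alph)
words-suc k alph = concatMap-map≡cartesianProductWith _∷_ alph (words k alph)

∈-words⁻ : ∀ k alph {w} → w ∈ words k alph → length w ≡ k × All (_∈ alph) w
∈-words⁻ zero    alph (here refl) = refl , []
∈-words⁻ (suc k) alph w∈
  with a , w′ , a∈ , w′∈ , refl ←
         ∈-cartesianProductWith⁻ _∷_ alph _ (subst (_ ∈_) (words-suc k alph) w∈)
  with ∈-words⁻ k alph w′∈
... | refl , w′⊆alph = refl , a∈ ∷ w′⊆alph

∈-words⁺ : ∀ k alph {w} → length w ≡ k → All (_∈ alph) w → w ∈ words k alph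
∈-words⁺ zero    alph {[]}    _   _              = here refl
∈-words⁺ (suc k) alph {a ∷ w} len (a∈ ∷ w⊆alph) = subst (_ ∈_) (sym (words-suc k alph))
  (∈-cartesianProductWith⁺ _∷_ a∈ (∈-words⁺ k alph (suc-injective len) w⊆alph))

unique-words : ∀ k alph → Unique alph → Unique (words k alph)
unique-words zero    alph _     = [] ∷ []
unique-words (suc k) alph ualph = subst Unique (sym (words-suc k alph))
  (UniqueP.cartesianProductWith⁺ _∷_ ∷-injective ualph (unique-words k alph ualph))

⊗≡cartesianProductWith : ∀ X Y → X ⊗ Y ≡ cartesianProductWith _++_ X Y
⊗≡cartesianProductWith = concatMap-map≡cartesianProductWith _++_

∈-⊗⁻ : ∀ X Y {w} → w ∈ X ⊗ Y → ∃[ u ] ∃[ v ] (u ∈ X × v ∈ Y × w ≡ u ++ v)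
∈-⊗⁻ X Y w∈ = ∈-cartesianProductWith⁻ _++_ X Y (subst (_ ∈_) (⊗≡cartesianProductWith X Y) w∈)

∈-⊗⁺ : ∀ {X Y u v} → u ∈ X → v ∈ Y → u ++ v ∈ X ⊗ Y
∈-⊗⁺ {X} {Y} u∈ v∈ =
  subst (_ ∈_) (sym (⊗≡cartesianProductWith X Y)) (∈-cartesianProductWith⁺ _++_ u∈ v∈)

unique-⊗ : ∀ {k X Y} → All (λ u → length u ≡ k) X → Unique X → Unique Y → Unique (X ⊗ Y)
unique-⊗ {X = []}    []          []            uY = []
unique-⊗ {k} {u ∷ X} {Y} (lu ∷ lX) (u∉X ∷ uX) uY =
  UniqueP.++⁺ (UniqueP.map⁺ (++-cancelˡ u _ _) uY) (unique-⊗ lX uX uY) disjoint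
  where
  disjoint : Disjoint (map (u ++_) Y) (X ⊗ Y)
  disjoint (w∈uY , w∈XY)
    with v , v∈ , refl ← ∈-map⁻ (u ++_) w∈uY
    with u′ , v′ , u′∈ , v′∈ , eq ← ∈-⊗⁻ X Y w∈XY
    = All.lookup u∉X u′∈ (++-injectiveˡ-sameLength u u′ (trans lu (sym (All.lookup lX u′∈))) eq)

∈-S⁻ : ∀ {k m u} → u ∈ S k m → length u ≡ k × Linked _≤_ u × All (_≤ m) u
∈-S⁻ {k} {m} u∈ with u∈words , linked ← ∈-filter⁻ (linked? _≤?_) {xs = words k (upTo (suc m))} u∈
  with len , u⊆ ← ∈-words⁻ k (upTo (suc m)) u∈words = len , linked , All.map (≤-pred ∘ ∈-upTo⁻) u⊆

∈-S⁺ : ∀ {k m u} → length u ≡ k → Linked _≤_ u → All (_≤ m) u → u ∈ S k m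
∈-S⁺ {k} {m} len linked u≤m =
  ∈-filter⁺ (linked? _≤?_) (∈-words⁺ k (upTo (suc m)) len (All.map (∈-upTo⁺ ∘ s≤s) u≤m)) linked

-- Positions are 1-based; position 0 and positions past the end read the junk value 0.
at : List ℕ → ℕ → ℕ
at []       _             = 0
at (x ∷ xs) zero          = 0
at (x ∷ xs) (suc zero)    = x
at (x ∷ xs) (suc (suc j)) = at xs (suc j)

at-∷ : ∀ x xs {j} → 0 < j → at (x ∷ xs) (suc j) ≡ at xs j
at-∷ x xs {suc j} _ = refl

at-∈ : ∀ {xs j} → 0 < j → j ≤ length xs → at xs j ∈ xs
at-∈ {x ∷ xs} {suc zero}    _ _         = here refl
at-∈ {x ∷ xs} {suc (suc j)} _ (s≤s j≤) = there (at-∈ (s≤s z≤n) j≤)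

posOf-bounded : ∀ {v xs} → v ∈ xs → 0 < posOf v xs × posOf v xs ≤ length xs
posOf-bounded {v} {x ∷ xs} v∈ with v ≟ x
... | yes refl rewrite posOf-here v xs = s≤s z≤n , s≤s z≤n
... | no v≢x rewrite posOf-there xs v≢x = s≤s z≤n , s≤s (proj₂ (posOf-bounded (∈-∷⁻ v∈ v≢x)))

at-posOf : ∀ {v xs} → v ∈ xs → at xs (posOf v xs) ≡ v
at-posOf {v} {x ∷ xs} v∈ with v ≟ x
... | yes refl rewrite posOf-here v xs = refl
... | no v≢x rewrite posOf-there xs v≢x =
  trans (at-∷ x xs (proj₁ (posOf-bounded (∈-∷⁻ v∈ v≢x)))) (at-posOf (∈-∷⁻ v∈ v≢x))

posOf-at : ∀ {xs j} → Unique xs → 0 < j → j ≤ length xs → posOf (at xs j) xs ≡ j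
posOf-at {x ∷ xs} {suc zero}    _             _ _         = posOf-here x xs
posOf-at {x ∷ xs} {suc (suc j)} (x∉xs ∷ uxs) _ (s≤s j≤) =
  trans (posOf-there xs (λ xⱼ≡x → All.lookup x∉xs xⱼ∈ (sym xⱼ≡x)))
        (cong suc (posOf-at uxs (s≤s z≤n) j≤))
  where
  xⱼ∈ : at xs (suc j) ∈ xs
  xⱼ∈ = at-∈ (s≤s z≤n) j≤

posOf-injective : ∀ {xs v w} → v ∈ xs → w ∈ xs → posOf v xs ≡ posOf w xs → v ≡ w
posOf-injective {xs} v∈ w∈ eq = trans (sym (at-posOf v∈)) (trans (cong (at xs) eq) (at-posOf w∈))

at-map-interval : ∀ (f : ℕ → ℕ) a k i → i < k → at (map f (interval a k)) (suc i) ≡ f (a + i)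
at-map-interval f a (suc k) zero    _        = cong f (sym (+-identityʳ a))
at-map-interval f a (suc k) (suc i) (s≤s i<k) =
  trans (at-map-interval f (suc a) k i i<k) (cong f (sym (+-suc a i)))

map-at-interval : ∀ xs → map (at xs) (interval 1 (length xs)) ≡ xs
map-at-interval []       = refl
map-at-interval (x ∷ xs) = cong (x ∷_) (trans (drop-head 0 (length xs)) (map-at-interval xs))
  where
  drop-head : ∀ a k → map (at (x ∷ xs)) (interval (2 + a) k) ≡ map (at xs) (interval (suc a) k)
  drop-head a zero    = refl
  drop-head a (suc k) = cong (at xs (suc a) ∷_) (drop-head (suc a) k)

posOf-map : ∀ (f : ℕ → ℕ) {xs x} → x ∈ xs → (∀ {y} → y ∈ xs → f y ≡ f x → y ≡ x) →
  posOf (f x) (map f xs) ≡ posOf x xs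
posOf-map f {y ∷ xs} {x} x∈ only-x with x ≟ y
... | yes refl = trans (posOf-here (f x) (map f xs)) (sym (posOf-here x xs))
... | no x≢y   = begin
  posOf (f x) (f y ∷ map f xs) ≡⟨ posOf-there (map f xs) (x≢y ∘ sym ∘ only-x (here refl) ∘ sym) ⟩
  suc (posOf (f x) (map f xs)) ≡⟨ cong suc (posOf-map f (∈-∷⁻ x∈ x≢y) (only-x ∘ there)) ⟩
  suc (posOf x xs)             ≡⟨ sym (posOf-there xs x≢y) ⟩
  posOf x (y ∷ xs)             ∎
  where open ≡-Reasoning

at-++ˡ : ∀ u v {j} → 0 < j → j ≤ length u → at (u ++ v) j ≡ at u j
at-++ˡ (x ∷ u) v {suc zero}    _ _        = refl
at-++ˡ (x ∷ u) v {suc (suc j)} _ (s≤s j≤) = at-++ˡ u v (s≤s z≤n) j≤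

at-++ʳ : ∀ u v {j} → 0 < j → at (u ++ v) (length u + j) ≡ at v j
at-++ʳ []      v _   = refl
at-++ʳ (x ∷ u) v 0<j = trans (at-∷ x (u ++ v) (<-≤-trans 0<j (m≤n+m _ (length u)))) (at-++ʳ u v 0<j)

Linked-at⁺ : ∀ u → (∀ j → 0 < j → j < length u → at u j ≤ at u (suc j)) → Linked _≤_ u
Linked-at⁺ []          _   = []
Linked-at⁺ (x ∷ [])    _   = [-]
Linked-at⁺ (x ∷ y ∷ u) asc = asc 1 (s≤s z≤n) (s≤s (s≤s z≤n)) ∷
  Linked-at⁺ (y ∷ u) (λ j 0<j j< →
    subst₂ _≤_ (at-∷ x (y ∷ u) 0<j) (at-∷ x (y ∷ u) {suc j} (s≤s z≤n))
               (asc (suc j) (s≤s z≤n) (s≤s j<)))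

Linked-at⁻ : ∀ u → Linked _≤_ u → ∀ j → 0 < j → j < length u → at u j ≤ at u (suc j)
Linked-at⁻ (x ∷ [])    [-]          (suc zero)    _ (s≤s ())
Linked-at⁻ (x ∷ y ∷ u) (x≤y ∷ _)   (suc zero)    _ _         = x≤y
Linked-at⁻ (x ∷ y ∷ u) (_ ∷ linked) (suc (suc j)) _ (s≤s j<) =
  Linked-at⁻ (y ∷ u) linked (suc j) (s≤s z≤n) j<

All-at⁺ : ∀ {P : ℕ → Set} u → (∀ j → 0 < j → j ≤ length u → P (at u j)) → All P u
All-at⁺     []      _  = []
All-at⁺ {P} (x ∷ u) pu = pu 1 (s≤s z≤n) (s≤s z≤n) ∷
  All-at⁺ u (λ j 0<j j≤ → subst P (at-∷ x u 0<j) (pu (suc j) (s≤s z≤n) (s≤s j≤)))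

All-at⁻ : ∀ {P : ℕ → Set} u → All P u → ∀ j → 0 < j → j ≤ length u → P (at u j)
All-at⁻ (x ∷ u) (px ∷ _)  (suc zero)    _ _        = px
All-at⁻ (x ∷ u) (_ ∷ pu) (suc (suc j)) _ (s≤s j≤) = All-at⁻ u pu (suc j) (s≤s z≤n) j≤

Linked-at-monotone : ∀ u → Linked _≤_ u → ∀ {j k} → 0 < j → j ≤ k → k ≤ length u →
  at u j ≤ at u k
Linked-at-monotone (x ∷ u)     _          {suc zero}    {suc zero}    _ _         _         = ≤-refl
Linked-at-monotone (x ∷ [])    _          {suc zero}    {suc (suc k)} _ _         (s≤s ())
Linked-at-monotone (x ∷ y ∷ u) (x≤y ∷ lk) {suc zero}    {suc (suc k)} _ _         (s≤s k≤) =
  ≤-trans x≤y (Linked-at-monotone (y ∷ u) lk {1} (s≤s z≤n) (s≤s z≤n) k≤)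
Linked-at-monotone (x ∷ y ∷ u) (_ ∷ lk)   {suc (suc j)} {suc (suc k)} _ (s≤s j≤k) (s≤s k≤) =
  Linked-at-monotone (y ∷ u) lk (s≤s z≤n) j≤k k≤

record Precedes (xs : List ℕ) (x y : ℕ) : Set where
  constructor precedes
  field posOf-< : posOf x xs < posOf y xs
open Precedes

module _ {z : ℕ} {xs : List ℕ} {x y : ℕ} where

  precedes-∷⁻ : x ≢ z → y ≢ z → Precedes (z ∷ xs) x y → Precedes xs x y
  precedes-∷⁻ x≢z y≢z (precedes x≺y) =
    precedes (≤-pred (subst₂ _<_ (posOf-there xs x≢z) (posOf-there xs y≢z) x≺y))

  precedes-∷⁺ : x ≢ z → y ≢ z → Precedes xs x y → Precedes (z ∷ xs) x y
  precedes-∷⁺ x≢z y≢z (precedes x≺y) =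
    precedes (subst₂ _<_ (sym (posOf-there xs x≢z)) (sym (posOf-there xs y≢z)) (s≤s x≺y))

head-precedes : ∀ {z xs y} → y ≢ z → y ∈ xs → Precedes (z ∷ xs) z y
head-precedes {z} {xs} y≢z y∈ =
  precedes (subst₂ _<_ (sym (posOf-here z xs)) (sym (posOf-there xs y≢z)) (s≤s (proj₁ (posOf-bounded y∈))))

¬precedes-head : ∀ {z xs x} → ¬ Precedes (z ∷ xs) x z
¬precedes-head {z} {xs} {x} (precedes x≺z) with x ≟ z
... | yes refl rewrite posOf-here z xs = <-irrefl refl x≺z
... | no x≢z rewrite posOf-there xs x≢z | posOf-here z xs with x≺z
...   | s≤s ()

module _ {P : ℕ → Set} (P? : (x : ℕ) → Dec (P x)) where

  precedes-filter⁻ : ∀ {xs x y} → x ∈ xs → y ∈ xs → P x → P y →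
    Precedes (filter P? xs) x y → Precedes xs x y
  precedes-filter⁻ {z ∷ xs} {x} {y} x∈ y∈ px py x≺y with x ≟ z | y ≟ z
  ... | _        | yes refl = ⊥-elim (¬precedes-head (subst (λ F → Precedes F x z) (filter-accept P? py) x≺y))
  ... | yes refl | no y≢z   = head-precedes y≢z (∈-∷⁻ y∈ y≢z)
  ... | no x≢z   | no y≢z with P? z
  ...   | yes _ = precedes-∷⁺ x≢z y≢z
    (precedes-filter⁻ (∈-∷⁻ x∈ x≢z) (∈-∷⁻ y∈ y≢z) px py (precedes-∷⁻ x≢z y≢z x≺y))
  ...   | no _  = precedes-∷⁺ x≢z y≢z
    (precedes-filter⁻ (∈-∷⁻ x∈ x≢z) (∈-∷⁻ y∈ y≢z) px py x≺y)

  precedes-filter⁺ : ∀ {xs x y} → x ∈ xs → y ∈ xs → P x → P y →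
    Precedes xs x y → Precedes (filter P? xs) x y
  precedes-filter⁺ {z ∷ xs} {x} {y} x∈ y∈ px py x≺y with x ≟ z | y ≟ z
  ... | _        | yes refl = ⊥-elim (¬precedes-head x≺y)
  ... | yes refl | no y≢z   = subst (λ F → Precedes F x y) (sym (filter-accept P? px))
                                (head-precedes y≢z (∈-filter⁺ P? (∈-∷⁻ y∈ y≢z) py))
  ... | no x≢z   | no y≢z with P? z
  ...   | yes _ = precedes-∷⁺ x≢z y≢z
    (precedes-filter⁺ (∈-∷⁻ x∈ x≢z) (∈-∷⁻ y∈ y≢z) px py (precedes-∷⁻ x≢z y≢z x≺y))
  ...   | no _  =
    precedes-filter⁺ (∈-∷⁻ x∈ x≢z) (∈-∷⁻ y∈ y≢z) px py (precedes-∷⁻ x≢z y≢z x≺y)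

ConsecutiveOrdered : List ℕ → ℕ → ℕ → Set
ConsecutiveOrdered xs a k = ∀ j → j ∈ interval a k → suc j ∈ interval a k → Precedes xs j (suc j)

∈-interval-predecessor : ∀ {a k x} → x ∈ interval a k → a ≢ x →
  ∃[ j ] (x ≡ suc j × j ∈ interval a k)
∈-interval-predecessor {x = zero}  x∈ a≢x = ⊥-elim (a≢x (n≤0⇒n≡0 (proj₁ (∈-interval⁻ x∈))))
∈-interval-predecessor {x = suc j} x∈ a≢x =
  let a≤x , x<a+k = ∈-interval⁻ x∈
  in j , refl , ∈-interval⁺ (≤-pred (≤∧≢⇒< a≤x a≢x)) (<-trans (n<1+n j) x<a+k)

-- The head of such an arrangement has no predecessor in the interval, so it is its minimum a.
ordered-arrangement≡interval : ∀ a k {xs} → Unique xs → (∀ {x} → x ∈ xs → x ∈ interval a k) →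
  (∀ {x} → x ∈ interval a k → x ∈ xs) → ConsecutiveOrdered xs a k → xs ≡ interval a k
ordered-arrangement≡interval a zero    {[]}     _ _ _ _ = refl
ordered-arrangement≡interval a zero    {z ∷ xs} _ ⊆I _ _ with ⊆I (here refl)
... | ()
ordered-arrangement≡interval a (suc k) {[]}     _ _ I⊆ _ with I⊆ (here refl)
... | ()
ordered-arrangement≡interval a (suc k) {z ∷ xs} (z∉xs ∷ uxs) ⊆I I⊆ ordered with a ≟ z
... | no a≢z with j , refl , j∈ ← ∈-interval-predecessor (⊆I (here refl)) a≢z =
  ⊥-elim (¬precedes-head (ordered j j∈ (⊆I (here refl))))
... | yes refl = cong (a ∷_) (ordered-arrangement≡interval (suc a) k uxs ⊆I′ I⊆′ ordered′)
  where
  a<_ : ∀ {x} → x ∈ interval (suc a) k → a < x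
  a< x∈ = proj₁ (∈-interval⁻ x∈)
  ⊆I′ : ∀ {x} → x ∈ xs → x ∈ interval (suc a) k
  ⊆I′ x∈ = ∈-∷⁻ (⊆I (there x∈)) (λ x≡a → All.lookup z∉xs x∈ (sym x≡a))
  I⊆′ : ∀ {x} → x ∈ interval (suc a) k → x ∈ xs
  I⊆′ x∈ = ∈-∷⁻ (I⊆ (there x∈)) (>⇒≢ (a< x∈))
  ordered′ : ConsecutiveOrdered xs (suc a) k
  ordered′ j j∈ 1+j∈ =
    precedes-∷⁻ (>⇒≢ (a< j∈)) (>⇒≢ (a< 1+j∈)) (ordered j (there j∈) (there 1+j∈))

interval-consecutiveOrdered : ∀ a k → ConsecutiveOrdered (interval a k) a k
interval-consecutiveOrdered a k j j∈ 1+j∈ =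
  precedes (subst₂ _<_ (sym (posOf-interval j∈)) (sym (posOf-interval 1+j∈))
  (s≤s (subst (suc (j ∸ a) ≤_) (sym (+-∸-assoc 1 (proj₁ (∈-interval⁻ j∈)))) ≤-refl)))

module _ {τ a k} (I⊆τ : ∀ {x} → x ∈ interval a k → x ∈ τ) where

  subword≡interval⇒ordered : filter (_∈? interval a k) τ ≡ interval a k → ConsecutiveOrdered τ a k
  subword≡interval⇒ordered eq j j∈ 1+j∈ =
    precedes-filter⁻ (_∈? interval a k) (I⊆τ j∈) (I⊆τ 1+j∈) j∈ 1+j∈
    (subst (λ xs → Precedes xs j (suc j)) (sym eq) (interval-consecutiveOrdered a k j j∈ 1+j∈))

  ordered⇒subword≡interval : Unique τ → ConsecutiveOrdered τ a k →
    filter (_∈? interval a k) τ ≡ interval a k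
  ordered⇒subword≡interval uτ ordered =
    ordered-arrangement≡interval a k (UniqueP.filter⁺ (_∈? interval a k) uτ)
    (λ x∈ → proj₂ (∈-filter⁻ (_∈? interval a k) {xs = τ} x∈))
    (λ x∈ → ∈-filter⁺ (_∈? interval a k) (I⊆τ x∈) x∈)
    (λ j j∈ 1+j∈ →
      precedes-filter⁺ (_∈? interval a k) (I⊆τ j∈) (I⊆τ 1+j∈) j∈ 1+j∈ (ordered j j∈ 1+j∈))

record IsPermutation (n : ℕ) (σ : List ℕ) : Set where
  field
    length≡  : length σ ≡ n
    unique   : Unique σ
    bounded  : ∀ {x} → x ∈ σ → 0 < x × x ≤ n
    complete : ∀ {x} → 0 < x → x ≤ n → x ∈ σ
open IsPermutation public

-- Pigeonhole: n letters covering {1..n} are pairwise distinct.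
covering⇒IsPermutation : ∀ {n σ} → length σ ≡ n → (∀ {x} → x ∈ σ → 0 < x × x ≤ n) →
  (∀ {x} → 0 < x → x ≤ n → x ∈ σ) → IsPermutation n σ
covering⇒IsPermutation {n} {σ} len bnd cov = record
  { length≡ = len ; unique = length-≤-deduplicate⇒Unique σ σ≤dedup ; bounded = bnd ; complete = cov }
  where
  σ≤dedup : length σ ≤ length (deduplicate _≟_ σ)
  σ≤dedup = subst (_≤ _) (trans (length-range n) (sym len))
    (Unique-⊆⇒length-≤ (unique-range n) (λ x∈ →
      let 0<x , x≤n = ∈-range⁻ x∈ in ∈-deduplicate⁺ _≟_ (cov 0<x x≤n)))

∈-Sym⁻ : ∀ {n σ} → σ ∈ Sym n → IsPermutation n σ
∈-Sym⁻ {n} σ∈ with σ∈words , isPerm ← ∈-filter⁻ (isPerm? n) σ∈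
  with ∈-words⁻ n (range n) σ∈words
... | len , σ⊆range = covering⇒IsPermutation len (∈-range⁻ ∘ All.lookup σ⊆range)
                        (λ 0<x x≤n → All.lookup isPerm (∈-range⁺ 0<x x≤n))

∈-Sym⁺ : ∀ {n σ} → IsPermutation n σ → σ ∈ Sym n
∈-Sym⁺ {n} p = ∈-filter⁺ (isPerm? n)
  (∈-words⁺ n (range n) (length≡ p)
    (All.tabulate (λ x∈ → let 0<x , x≤n = bounded p x∈ in ∈-range⁺ 0<x x≤n)))
  (All.tabulate (λ x∈ → let 0<x , x≤n = ∈-range⁻ x∈ in complete p 0<x x≤n))

unique-Sym : ∀ n → Unique (Sym n)
unique-Sym n = UniqueP.filter⁺ (isPerm? n) (unique-words n (range n) (unique-range n))

inv≡map-posOf : ∀ {n} σ → length σ ≡ n → inv σ ≡ map (λ v → posOf v σ) (interval 1 n)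
inv≡map-posOf {n} σ len = cong (map (λ v → posOf v σ)) (trans (cong range len) (range≡interval n))

module _ {n σ} (p : IsPermutation n σ) where

  private
    pos : ℕ → ℕ
    pos v = posOf v σ

    inv≡ : inv σ ≡ map pos (interval 1 n)
    inv≡ = inv≡map-posOf σ (length≡ p)

    j≤len : ∀ {j} → j ≤ n → j ≤ length σ
    j≤len = subst (_ ≤_) (sym (length≡ p))

    σ⊆interval : ∀ {v} → v ∈ σ → v ∈ interval 1 n
    σ⊆interval v∈ = let 0<v , v≤n = bounded p v∈ in ∈-interval⁺ 0<v (s≤s v≤n)

    interval⊆σ : ∀ {v} → v ∈ interval 1 n → v ∈ σ
    interval⊆σ v∈ = let 0<v , v<1+n = ∈-interval⁻ v∈ in complete p 0<v (≤-pred v<1+n)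

  posOf-inv : ∀ {j} → 0 < j → j ≤ n → posOf j (inv σ) ≡ at σ j
  posOf-inv {j} 0<j j≤n = begin
    posOf j (inv σ)                          ≡⟨ cong (posOf j) inv≡ ⟩
    posOf j (map pos (interval 1 n))         ≡⟨ cong (λ i → posOf i (map pos (interval 1 n))) (sym pos-σⱼ≡j) ⟩
    posOf (pos σⱼ) (map pos (interval 1 n))  ≡⟨ posOf-map pos (σ⊆interval σⱼ∈) only-σⱼ ⟩
    posOf σⱼ (interval 1 n)                  ≡⟨ posOf-interval (σ⊆interval σⱼ∈) ⟩
    suc (σⱼ ∸ 1)                             ≡⟨ m+[n∸m]≡n (proj₁ (bounded p σⱼ∈)) ⟩
    σⱼ                                       ∎
    where
    open ≡-Reasoning
    σⱼ : ℕ
    σⱼ = at σ j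
    σⱼ∈ : σⱼ ∈ σ
    σⱼ∈ = at-∈ 0<j (j≤len j≤n)
    pos-σⱼ≡j : pos σⱼ ≡ j
    pos-σⱼ≡j = posOf-at (unique p) 0<j (j≤len j≤n)
    only-σⱼ : ∀ {y} → y ∈ interval 1 n → pos y ≡ pos σⱼ → y ≡ σⱼ
    only-σⱼ y∈ = posOf-injective (interval⊆σ y∈) σⱼ∈

  inv-isPermutation : IsPermutation n (inv σ)
  inv-isPermutation = covering⇒IsPermutation len bnd cov
    where
    len : length (inv σ) ≡ n
    len = trans (cong length inv≡) (trans (length-map pos (interval 1 n)) (length-interval 1 n))
    bnd : ∀ {x} → x ∈ inv σ → 0 < x × x ≤ n
    bnd x∈ with v , v∈ , refl ← ∈-map⁻ pos (subst (_ ∈_) inv≡ x∈) =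
      let 0<pos , pos≤ = posOf-bounded (interval⊆σ v∈) in 0<pos , subst (_ ≤_) (length≡ p) pos≤
    cov : ∀ {x} → 0 < x → x ≤ n → x ∈ inv σ
    cov 0<x x≤n = subst (_ ∈_) (sym inv≡) (subst (_∈ _) (posOf-at (unique p) 0<x (j≤len x≤n))
      (∈-map⁺ pos (σ⊆interval (at-∈ 0<x (j≤len x≤n)))))

  inv-involutive : inv (inv σ) ≡ σ
  inv-involutive = begin
    inv (inv σ)                                ≡⟨ inv≡map-posOf (inv σ) (length≡ inv-isPermutation) ⟩
    map (λ v → posOf v (inv σ)) (interval 1 n) ≡⟨ map-cong-local (All.tabulate posOf-inv′) ⟩
    map (at σ) (interval 1 n)                  ≡⟨ cong (map (at σ) ∘ interval 1) (sym (length≡ p)) ⟩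
    map (at σ) (interval 1 (length σ))         ≡⟨ map-at-interval σ ⟩
    σ                                          ∎
    where
    open ≡-Reasoning
    posOf-inv′ : ∀ {v} → v ∈ interval 1 n → posOf v (inv σ) ≡ at σ v
    posOf-inv′ v∈ = let 0<v , v<1+n = ∈-interval⁻ v∈ in posOf-inv 0<v (≤-pred v<1+n)

module _ (P : ℕ → Set) where

  All-descentsFrom⁻ : ∀ k xs → All P (descentsFrom k xs) →
    ∀ i → suc i < length xs → at xs (2 + i) < at xs (suc i) → P (k + i)
  All-descentsFrom⁻ k (x ∷ []) _ i (s≤s ())
  All-descentsFrom⁻ k (x ∷ y ∷ r) all i i<len desc with y <? x
  All-descentsFrom⁻ k (x ∷ y ∷ r) (pk ∷ _)   zero    _           _    | yes _ =
    subst P (sym (+-identityʳ k)) pk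
  All-descentsFrom⁻ k (x ∷ y ∷ r) (_ ∷ all) (suc i) (s≤s i<len) desc | yes _ =
    subst P (sym (+-suc k i)) (All-descentsFrom⁻ (suc k) (y ∷ r) all i i<len desc)
  All-descentsFrom⁻ k (x ∷ y ∷ r) all zero    _           desc | no y≮x = ⊥-elim (y≮x desc)
  All-descentsFrom⁻ k (x ∷ y ∷ r) all (suc i) (s≤s i<len) desc | no _ =
    subst P (sym (+-suc k i)) (All-descentsFrom⁻ (suc k) (y ∷ r) all i i<len desc)

  All-descentsFrom⁺ : ∀ k xs → (∀ i → suc i < length xs → at xs (2 + i) < at xs (suc i) → P (k + i)) →
    All P (descentsFrom k xs)
  All-descentsFrom⁺ k []          _ = []
  All-descentsFrom⁺ k (x ∷ [])    _ = []
  All-descentsFrom⁺ k (x ∷ y ∷ r) h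
    with y <? x | All-descentsFrom⁺ (suc k) (y ∷ r) (λ i i<len → subst P (+-suc k i) ∘ h (suc i) (s≤s i<len))
  ... | yes y<x | rest = subst P (+-identityʳ k) (h 0 (s≤s (s≤s z≤n)) y<x) ∷ rest
  ... | no _    | rest = rest

DescentsAtCuts : List ℕ → List ℕ → Set
DescentsAtCuts I σ = ∀ j → 0 < j → j < length σ → at σ (suc j) < at σ j → j ∈ cuts I

InD≤⇒DescentsAtCuts : ∀ {I} σ → InD≤ I σ → DescentsAtCuts I σ
InD≤⇒DescentsAtCuts {I} σ d (suc i) _ = All-descentsFrom⁻ (_∈ cuts I) 1 σ d i

DescentsAtCuts⇒InD≤ : ∀ {I} σ → DescentsAtCuts I σ → InD≤ I σ
DescentsAtCuts⇒InD≤ {I} σ h = All-descentsFrom⁺ (_∈ cuts I) 1 σ (λ i → h (suc i) (s≤s z≤n))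

∈-cutsFrom-∷⁻ : ∀ acc i r {x} → x ∈ cutsFrom acc (i ∷ r) → x ≡ acc + i ⊎ x ∈ cutsFrom (acc + i) r
∈-cutsFrom-∷⁻ acc i (_ ∷ _) (here x≡)  = inj₁ x≡
∈-cutsFrom-∷⁻ acc i (_ ∷ _) (there x∈) = inj₂ x∈

∈-cutsFrom-∷⁺ : ∀ acc i r {x} → x ∈ cutsFrom (acc + i) r → x ∈ cutsFrom acc (i ∷ r)
∈-cutsFrom-∷⁺ acc i (_ ∷ _) x∈ = there x∈

cutsFrom-lowerBound : ∀ acc I {x} → x ∈ cutsFrom acc I → acc ≤ x
cutsFrom-lowerBound acc (i ∷ r) x∈ with ∈-cutsFrom-∷⁻ acc i r x∈
... | inj₁ refl = m≤m+n acc i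
... | inj₂ x∈′  = ≤-trans (m≤m+n acc i) (cutsFrom-lowerBound (acc + i) r x∈′)

block≡interval : ∀ acc i → map (acc +_) (range i) ≡ interval (suc acc) i
block≡interval acc i = begin
  map (acc +_) (range i)      ≡⟨ cong (map (acc +_)) (range≡interval i) ⟩
  map (acc +_) (interval 1 i) ≡⟨ map-+-interval acc 1 i ⟩
  interval (acc + 1) i        ≡⟨ cong (λ a → interval a i) (+-comm acc 1) ⟩
  interval (suc acc) i        ∎
  where open ≡-Reasoning

∈-blocksFrom⁻ : ∀ acc I {b} → b ∈ blocksFrom acc I →
  ∃[ a ] ∃[ k ] (b ≡ interval (suc a) k × a + k ≤ acc + sum I)
∈-blocksFrom⁻ acc (i ∷ r) (here refl) = acc , i , block≡interval acc i , +-monoʳ-≤ acc (m≤m+n i (sum r))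
∈-blocksFrom⁻ acc (i ∷ r) (there b∈) with a , k , refl , a+k≤ ← ∈-blocksFrom⁻ (acc + i) r b∈ =
  a , k , refl , subst (a + k ≤_) (+-assoc acc i (sum r)) a+k≤

NonCutFrom : ℕ → List ℕ → ℕ → Set
NonCutFrom acc I j = acc < j × suc j ≤ acc + sum I × j ∉ cutsFrom acc I

SameBlockFrom : ℕ → List ℕ → ℕ → Set
SameBlockFrom acc I j = ∃[ b ] (b ∈ blocksFrom acc I × j ∈ b × suc j ∈ b)

sameBlock⇒nonCut : ∀ acc I {j} → SameBlockFrom acc I j → NonCutFrom acc I j
sameBlock⇒nonCut acc (i ∷ r) {j} (b , here refl , j∈ , 1+j∈) =
  acc<j , ≤-trans 1+j≤acc+i (+-monoʳ-≤ acc (m≤m+n i (sum r))) , j∉cuts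
  where
  acc<j : acc < j
  acc<j = proj₁ (∈-interval⁻ (subst (j ∈_) (block≡interval acc i) j∈))
  1+j≤acc+i : suc j ≤ acc + i
  1+j≤acc+i = ≤-pred (proj₂ (∈-interval⁻ (subst (suc j ∈_) (block≡interval acc i) 1+j∈)))
  j∉cuts : j ∉ cutsFrom acc (i ∷ r)
  j∉cuts j∈cuts with ∈-cutsFrom-∷⁻ acc i r j∈cuts
  ... | inj₁ refl = <-irrefl refl 1+j≤acc+i
  ... | inj₂ j∈′  = <-irrefl refl (≤-trans 1+j≤acc+i (cutsFrom-lowerBound (acc + i) r j∈′))
sameBlock⇒nonCut acc (i ∷ r) {j} (b , there b∈ , j∈ , 1+j∈)
  with acc+i<j , 1+j≤ , j∉cuts ← sameBlock⇒nonCut (acc + i) r (b , b∈ , j∈ , 1+j∈) =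
  ≤-<-trans (m≤m+n acc i) acc+i<j , subst (suc j ≤_) (+-assoc acc i (sum r)) 1+j≤ , j∉cuts′
  where
  j∉cuts′ : j ∉ cutsFrom acc (i ∷ r)
  j∉cuts′ j∈cuts with ∈-cutsFrom-∷⁻ acc i r j∈cuts
  ... | inj₁ refl = <-irrefl refl acc+i<j
  ... | inj₂ j∈′  = j∉cuts j∈′

nonCut⇒sameBlock : ∀ acc I {j} → NonCutFrom acc I j → SameBlockFrom acc I j
nonCut⇒sameBlock acc [] {j} (acc<j , 1+j≤ , _) =
  ⊥-elim (<-irrefl refl (<-≤-trans acc<j (≤-trans (n≤1+n j) (subst (suc j ≤_) (+-identityʳ acc) 1+j≤))))
nonCut⇒sameBlock acc (i ∷ r) {j} (acc<j , 1+j≤ , j∉cuts) with suc j ≤? acc + i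
... | yes 1+j≤acc+i = map (acc +_) (range i) , here refl ,
  subst (j ∈_) (sym (block≡interval acc i)) (∈-interval⁺ acc<j (s≤s (≤-trans (n≤1+n j) 1+j≤acc+i))) ,
  subst (suc j ∈_) (sym (block≡interval acc i)) (∈-interval⁺ (≤-trans acc<j (n≤1+n j)) (s≤s 1+j≤acc+i))
... | no 1+j≰acc+i with j ≟ acc + i
...   | yes refl = ⊥-elim (j∉cuts (acc+i∈cuts r 1+j≤))
  where
  acc+i∈cuts : ∀ r → suc (acc + i) ≤ acc + (i + sum r) → acc + i ∈ cutsFrom acc (i ∷ r)
  acc+i∈cuts [] 1+j≤′ =
    ⊥-elim (1+j≰acc+i (subst (suc (acc + i) ≤_) (cong (acc +_) (+-identityʳ i)) 1+j≤′))
  acc+i∈cuts (_ ∷ _) _ = here refl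
...   | no j≢acc+i with b , b∈ , j∈b , 1+j∈b ← nonCut⇒sameBlock (acc + i) r
          ( ≤∧≢⇒< (≤-pred (≰⇒> 1+j≰acc+i)) (j≢acc+i ∘ sym)
          , subst (suc j ≤_) (sym (+-assoc acc i (sum r))) 1+j≤
          , j∉cuts ∘ ∈-cutsFrom-∷⁺ acc i r ) =
  b , there b∈ , j∈b , 1+j∈b

cutsFrom-+ : ∀ c d I → cutsFrom (c + d) I ≡ map (c +_) (cutsFrom d I)
cutsFrom-+ c d []          = refl
cutsFrom-+ c d (i ∷ [])    = refl
cutsFrom-+ c d (i ∷ k ∷ I) = cong₂ _∷_ (+-assoc c d i)
  (trans (cong (λ e → cutsFrom e (k ∷ I)) (+-assoc c d i)) (cutsFrom-+ c (d + i) (k ∷ I)))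

cutsFrom≡map-+-cuts : ∀ i r → cutsFrom i r ≡ map (i +_) (cuts r)
cutsFrom≡map-+-cuts i r = trans (cong (λ c → cutsFrom c r) (sym (+-identityʳ i))) (cutsFrom-+ i 0 r)

∈-cuts-∷⁻ : ∀ i r {x} → x ∈ cuts (i ∷ r) → x ≡ i ⊎ ∃[ y ] (y ∈ cuts r × x ≡ i + y)
∈-cuts-∷⁻ i r x∈ with ∈-cutsFrom-∷⁻ 0 i r x∈
... | inj₁ x≡i = inj₁ x≡i
... | inj₂ x∈′ = inj₂ (∈-map⁻ (i +_) (subst (_ ∈_) (cutsFrom≡map-+-cuts i r) x∈′))

∈-cuts-∷⁺ : ∀ i r {y} → y ∈ cuts r → i + y ∈ cuts (i ∷ r)
∈-cuts-∷⁺ i r y∈ =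
  ∈-cutsFrom-∷⁺ 0 i r (subst (_ ∈_) (sym (cutsFrom≡map-+-cuts i r)) (∈-map⁺ (i +_) y∈))

module _ (i : ℕ) (r : List ℕ) where

  nonCut-∷-inside : ∀ {j} → 0 < j → j < i → NonCutFrom 0 (i ∷ r) j
  nonCut-∷-inside 0<j j<i = 0<j , ≤-trans j<i (m≤m+n i (sum r)) , λ j∈ →
    case ∈-cuts-∷⁻ i r j∈ of λ where
    (inj₁ refl)           → <-irrefl refl j<i
    (inj₂ (y , _ , refl)) → <-irrefl refl (<-≤-trans j<i (m≤m+n i y))

  nonCut-∷-at : ¬ NonCutFrom 0 (i ∷ r) i
  nonCut-∷-at (_ , i<i+m , i∉cuts) = i∉cuts (i∈cuts r i<i+m)
    where
    i∈cuts : ∀ r′ → i < i + sum r′ → i ∈ cuts (i ∷ r′)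
    i∈cuts []      i<i+0 = ⊥-elim (<-irrefl (sym (+-identityʳ i)) i<i+0)
    i∈cuts (_ ∷ _) _     = here refl

  nonCut-∷-beyond⁺ : ∀ {j} → NonCutFrom 0 r j → NonCutFrom 0 (i ∷ r) (i + j)
  nonCut-∷-beyond⁺ {j} (0<j , j<m , j∉cuts) = <-≤-trans 0<j (m≤n+m j i) , +-monoʳ-< i j<m , λ i+j∈ →
    case ∈-cuts-∷⁻ i r i+j∈ of λ where
    (inj₁ i+j≡i)            → <-irrefl (sym (+-cancelˡ-≡ i j 0 (trans i+j≡i (sym (+-identityʳ i))))) 0<j
    (inj₂ (y , y∈ , i+j≡))  → j∉cuts (subst (_∈ cuts r) (sym (+-cancelˡ-≡ i j y i+j≡)) y∈)

  nonCut-∷-beyond⁻ : ∀ {j} → 0 < j → NonCutFrom 0 (i ∷ r) (i + j) → NonCutFrom 0 r j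
  nonCut-∷-beyond⁻ {j} 0<j (_ , i+j<i+m , i+j∉cuts) =
    0<j , +-cancelˡ-< i j (sum r) i+j<i+m , i+j∉cuts ∘ ∈-cuts-∷⁺ i r

OrderedOffCuts : List ℕ → List ℕ → Set
OrderedOffCuts I τ = ∀ j → NonCutFrom 0 I j → Precedes τ j (suc j)

module _ {I τ} (p : IsPermutation (sum I) τ) where

  private
    block⊆τ : ∀ {a k} → a + k ≤ sum I → ∀ {x} → x ∈ interval (suc a) k → x ∈ τ
    block⊆τ a+k≤ x∈ = let a<x , x<1+a+k = ∈-interval⁻ x∈
                      in complete p (≤-trans (s≤s z≤n) a<x) (≤-trans (≤-pred x<1+a+k) a+k≤)

  InShuffle⇒OrderedOffCuts : InShuffle I τ → OrderedOffCuts I τ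
  InShuffle⇒OrderedOffCuts sh j nonCut
    with b , b∈ , j∈b , 1+j∈b ← nonCut⇒sameBlock 0 I nonCut
    with a , k , refl , a+k≤ ← ∈-blocksFrom⁻ 0 I b∈ =
    subword≡interval⇒ordered (block⊆τ a+k≤) (All.lookup sh b∈) j j∈b 1+j∈b

  OrderedOffCuts⇒InShuffle : OrderedOffCuts I τ → InShuffle I τ
  OrderedOffCuts⇒InShuffle ordered = All.tabulate λ b∈ → blockSorted _ b∈ (∈-blocksFrom⁻ 0 I b∈)
    where
    blockSorted : ∀ b → b ∈ blocks I → ∃[ a ] ∃[ k ] (b ≡ interval (suc a) k × a + k ≤ sum I) →
      filter (_∈? b) τ ≡ b
    blockSorted b b∈ (a , k , refl , a+k≤) = ordered⇒subword≡interval (block⊆τ a+k≤) (unique p)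
      (λ j j∈ 1+j∈ → ordered j (sameBlock⇒nonCut 0 I (_ , b∈ , j∈ , 1+j∈)))

module _ {I σ} (p : IsPermutation (sum I) σ) where

  private
    n : ℕ
    n = sum I
    posOf-inv-< : ∀ {j} → 0 < j → j < n → Precedes (inv σ) j (suc j) → at σ j < at σ (suc j)
    posOf-inv-< 0<j j<n (precedes lt) = subst₂ _<_ (posOf-inv p 0<j (<⇒≤ j<n)) (posOf-inv p (s≤s z≤n) j<n) lt
    posOf-inv->  : ∀ {j} → 0 < j → j < n → at σ j < at σ (suc j) → Precedes (inv σ) j (suc j)
    posOf-inv-> 0<j j<n lt =
      precedes (subst₂ _<_ (sym (posOf-inv p 0<j (<⇒≤ j<n))) (sym (posOf-inv p (s≤s z≤n) j<n)) lt)
    j<len : ∀ {j} → j < n → j < length σ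
    j<len = subst (_ <_) (sym (length≡ p))

  InD≤⇒InShuffle-inv : InD≤ I σ → InShuffle I (inv σ)
  InD≤⇒InShuffle-inv d = OrderedOffCuts⇒InShuffle (inv-isPermutation p) ordered
    where
    ordered : OrderedOffCuts I (inv σ)
    ordered j (0<j , j<n , j∉cuts) with <-cmp (at σ j) (at σ (suc j))
    ... | tri< lt _ _ = posOf-inv-> 0<j j<n lt
    ... | tri≈ _ eq _ = ⊥-elim (<-irrefl (begin
      j                        ≡⟨ sym (posOf-at (unique p) 0<j (<⇒≤ (j<len j<n))) ⟩
      posOf (at σ j) σ         ≡⟨ cong (λ v → posOf v σ) eq ⟩
      posOf (at σ (suc j)) σ   ≡⟨ posOf-at (unique p) (s≤s z≤n) (j<len j<n) ⟩
      suc j                    ∎) (n<1+n j))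
      where open ≡-Reasoning
    ... | tri> _ _ gt = ⊥-elim (j∉cuts (InD≤⇒DescentsAtCuts σ d j 0<j (j<len j<n) gt))

  InShuffle-inv⇒InD≤ : InShuffle I (inv σ) → InD≤ I σ
  InShuffle-inv⇒InD≤ sh = DescentsAtCuts⇒InD≤ σ descentsAtCuts
    where
    descentsAtCuts : DescentsAtCuts I σ
    descentsAtCuts j 0<j j<len desc with j ∈? cuts I
    ... | yes j∈cuts = j∈cuts
    ... | no j∉cuts  = ⊥-elim (<-asym desc (posOf-inv-< 0<j j<n
      (InShuffle⇒OrderedOffCuts (inv-isPermutation p) sh j (0<j , j<n , j∉cuts))))
      where
      j<n : j < n
      j<n = subst (_ <_) (length≡ p) j<len

module _ (n : ℕ) {P : List ℕ → Set} (P? : (σ : List ℕ) → Dec (P σ)) where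

  ∈-filter-Sym⁻ : ∀ {σ} → σ ∈ filter P? (Sym n) → IsPermutation n σ × P σ
  ∈-filter-Sym⁻ σ∈ with σ∈Sym , pσ ← ∈-filter⁻ P? {xs = Sym n} σ∈ = ∈-Sym⁻ σ∈Sym , pσ

  ∈-filter-Sym⁺ : ∀ {σ} → IsPermutation n σ → P σ → σ ∈ filter P? (Sym n)
  ∈-filter-Sym⁺ p pσ = ∈-filter⁺ P? (∈-Sym⁺ p) pσ

  unique-filter-Sym : Unique (filter P? (Sym n))
  unique-filter-Sym = UniqueP.filter⁺ P? (unique-Sym n)

D≤ : List ℕ → List (List ℕ)
D≤ I = filter (inD≤? I) (Sym (sum I))

shuffles : List ℕ → List (List ℕ)
shuffles I = filter (inShuffle? I) (Sym (sum I))

inv-D≤↭shuffles : ∀ I → map inv (D≤ I) ↭ shuffles I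
inv-D≤↭shuffles I = unique∧set⇒↭ (map⁺-injectiveOn inv inv-injective (unique-filter-Sym n (inD≤? I)))
  (unique-filter-Sym n (inShuffle? I)) D≤⇒shuffle shuffle⇒D≤
  where
  n : ℕ
  n = sum I
  inv-injective : ∀ {σ σ′} → σ ∈ D≤ I → σ′ ∈ D≤ I → inv σ ≡ inv σ′ → σ ≡ σ′
  inv-injective σ∈ σ′∈ eq = trans (sym (inv-involutive (proj₁ (∈-filter-Sym⁻ n (inD≤? I) σ∈))))
    (trans (cong inv eq) (inv-involutive (proj₁ (∈-filter-Sym⁻ n (inD≤? I) σ′∈))))
  D≤⇒shuffle : ∀ {τ} → τ ∈ map inv (D≤ I) → τ ∈ shuffles I
  D≤⇒shuffle τ∈ with σ , σ∈ , refl ← ∈-map⁻ inv τ∈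
    with p , d ← ∈-filter-Sym⁻ n (inD≤? I) σ∈ =
    ∈-filter-Sym⁺ n (inShuffle? I) (inv-isPermutation p) (InD≤⇒InShuffle-inv p d)
  shuffle⇒D≤ : ∀ {τ} → τ ∈ shuffles I → τ ∈ map inv (D≤ I)
  shuffle⇒D≤ {τ} τ∈ with p , sh ← ∈-filter-Sym⁻ n (inShuffle? I) τ∈ =
    subst (_∈ _) (inv-involutive p) (∈-map⁺ inv (∈-filter-Sym⁺ n (inD≤? I) (inv-isPermutation p)
      (InShuffle-inv⇒InD≤ (inv-isPermutation p) (subst (InShuffle I) (sym (inv-involutive p)) sh))))

insert : ℕ → ℕ → List ℕ → List ℕ
insert zero    u ys       = u ∷ ys
insert (suc c) u []       = u ∷ []
insert (suc c) u (y ∷ ys) = y ∷ insert c u ys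

insert-↭ : ∀ c u ys → insert c u ys ↭ u ∷ ys
insert-↭ zero    u ys       = ↭-refl
insert-↭ (suc c) u []       = ↭-refl
insert-↭ (suc c) u (y ∷ ys) = ↭-trans (↭-prep y (insert-↭ c u ys)) (↭-swap y u ↭-refl)

posOf-insert-self : ∀ {u c ys} → u ∉ ys → c ≤ length ys → posOf u (insert c u ys) ≡ suc c
posOf-insert-self {u} {zero}  {ys}     _   _        = posOf-here u ys
posOf-insert-self {u} {suc c} {y ∷ ys} u∉ (s≤s c≤) =
  trans (posOf-there (insert c u ys) (u∉ ∘ here)) (cong suc (posOf-insert-self (u∉ ∘ there) c≤))

posOf-insert-before : ∀ {u v c ys} → v ≢ u → v ∈ ys → posOf v ys ≤ c →
  posOf v (insert c u ys) ≡ posOf v ys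
posOf-insert-before {c = zero} _ v∈ pos≤ =
  ⊥-elim (<-irrefl refl (≤-trans (proj₁ (posOf-bounded v∈)) pos≤))
posOf-insert-before {u} {v} {suc c} {y ∷ ys} v≢u v∈ pos≤ with v ≟ y
... | yes refl = trans (posOf-here v (insert c u ys)) (sym (posOf-here v ys))
... | no v≢y   = begin
  posOf v (y ∷ insert c u ys) ≡⟨ posOf-there (insert c u ys) v≢y ⟩
  suc (posOf v (insert c u ys)) ≡⟨ cong suc (posOf-insert-before v≢u (∈-∷⁻ v∈ v≢y) pos≤′) ⟩
  suc (posOf v ys)              ≡⟨ sym (posOf-there ys v≢y) ⟩
  posOf v (y ∷ ys)              ∎
  where
  open ≡-Reasoning
  pos≤′ : posOf v ys ≤ c
  pos≤′ = ≤-pred (subst (_≤ suc c) (posOf-there ys v≢y) pos≤)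

posOf-insert-after : ∀ {u v c ys} → v ≢ u → v ∈ ys → c < posOf v ys →
  posOf v (insert c u ys) ≡ suc (posOf v ys)
posOf-insert-after {c = zero} {ys} v≢u _ _ = posOf-there ys v≢u
posOf-insert-after {u} {v} {suc c} {y ∷ ys} v≢u v∈ c<pos with v ≟ y
... | yes refl with subst (suc c <_) (posOf-here v ys) c<pos
...   | s≤s ()
posOf-insert-after {u} {v} {suc c} {y ∷ ys} v≢u v∈ c<pos | no v≢y = begin
  posOf v (y ∷ insert c u ys)   ≡⟨ posOf-there (insert c u ys) v≢y ⟩
  suc (posOf v (insert c u ys)) ≡⟨ cong suc (posOf-insert-after v≢u (∈-∷⁻ v∈ v≢y) c<pos′) ⟩
  suc (suc (posOf v ys))        ≡⟨ cong suc (sym (posOf-there ys v≢y)) ⟩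
  suc (posOf v (y ∷ ys))        ∎
  where
  open ≡-Reasoning
  c<pos′ : c < posOf v ys
  c<pos′ = ≤-pred (subst (suc c <_) (posOf-there ys v≢y) c<pos)

code : ℕ → List ℕ → ℕ
code i σ = length (filter (i <?_) (takeWhile (λ x → ¬? (x ≟ i)) σ))

private
  takeWhile-≢-here : ∀ j τ → takeWhile (λ x → ¬? (x ≟ j)) (j ∷ τ) ≡ []
  takeWhile-≢-here j τ with j ≡ᵇ j in j≡ᵇj
  ... | true  = refl
  ... | false = ⊥-elim (subst T j≡ᵇj (≡⇒≡ᵇ j j refl))

  takeWhile-≢-there : ∀ {j z} τ → z ≢ j →
    takeWhile (λ x → ¬? (x ≟ j)) (z ∷ τ) ≡ z ∷ takeWhile (λ x → ¬? (x ≟ j)) τ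
  takeWhile-≢-there {j} {z} τ z≢j with z ≡ᵇ j in z≡ᵇj
  ... | false = refl
  ... | true  = ⊥-elim (z≢j (≡ᵇ⇒≡ z j (subst T (sym z≡ᵇj) tt)))

code-here : ∀ j τ → code j (j ∷ τ) ≡ 0
code-here j τ rewrite takeWhile-≢-here j τ = refl

code-there-> : ∀ {j z} τ → j < z → code j (z ∷ τ) ≡ suc (code j τ)
code-there-> {j} {z} τ j<z rewrite takeWhile-≢-there τ (>⇒≢ j<z)
  | filter-accept (j <?_) {xs = takeWhile (λ x → ¬? (x ≟ j)) τ} j<z = refl

code-there-≯ : ∀ {j z} τ → ¬ j < z → z ≢ j → code j (z ∷ τ) ≡ code j τ
code-there-≯ {j} {z} τ j≮z z≢j rewrite takeWhile-≢-there τ z≢j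
  | filter-reject (j <?_) {xs = takeWhile (λ x → ¬? (x ≟ j)) τ} j≮z = refl

Ic≡map-code : ∀ {n} σ → length σ ≡ n → Ic σ ≡ map (λ i → code i σ) (interval 1 n)
Ic≡map-code {n} σ len = cong (map (λ i → code i σ)) (trans (cong range len) (range≡interval n))

at-Ic : ∀ {n} σ {j} → length σ ≡ n → 0 < j → j ≤ n → at (Ic σ) j ≡ code j σ
at-Ic {n} σ {suc j} len _ j<n =
  trans (cong (λ w → at w (suc j)) (Ic≡map-code σ len)) (at-map-interval (λ i → code i σ) 1 n j j<n)

length-Ic : ∀ {n} σ → length σ ≡ n → length (Ic σ) ≡ n
length-Ic {n} σ len =
  trans (cong length (Ic≡map-code σ len)) (trans (length-map _ (interval 1 n)) (length-interval 1 n))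

code-insert-self : ∀ {i c ys} → (∀ {x} → x ∈ ys → i < x) → c ≤ length ys →
  code i (insert c i ys) ≡ c
code-insert-self {i} {zero}  {ys}     _    _        = code-here i ys
code-insert-self {i} {suc c} {y ∷ ys} i<ys (s≤s c≤) =
  trans (code-there-> (insert c i ys) (i<ys (here refl))) (cong suc (code-insert-self (i<ys ∘ there) c≤))

code-insert-other : ∀ {i j} c ys → i < j → code j (insert c i ys) ≡ code j ys
code-insert-other         zero    ys       i<j = code-there-≯ ys (<-asym i<j) (<⇒≢ i<j)
code-insert-other         (suc c) []       i<j = code-there-≯ [] (<-asym i<j) (<⇒≢ i<j)
code-insert-other {i} {j} (suc c) (y ∷ ys) i<j with y ≟ j
... | yes refl = trans (code-here y (insert c i ys)) (sym (code-here y ys))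
... | no y≢j with j <? y
...   | yes j<y = trans (code-there-> (insert c i ys) j<y)
                    (trans (cong suc (code-insert-other c ys i<j)) (sym (code-there-> ys j<y)))
...   | no j≮y  = trans (code-there-≯ (insert c i ys) j≮y y≢j)
                    (trans (code-insert-other c ys i<j) (sym (code-there-≯ ys j≮y y≢j)))

atLeast : ℕ → List ℕ → List ℕ
atLeast j τ = filter (j ≤?_) τ

∉-atLeast-suc : ∀ j τ → j ∉ atLeast (suc j) τ
∉-atLeast-suc j τ j∈ = <-irrefl refl (proj₂ (∈-filter⁻ (suc j ≤?_) {xs = τ} j∈))

atLeast-skip : ∀ j τ → j ∉ τ → atLeast j τ ≡ atLeast (suc j) τ
atLeast-skip j [] _ = refl
atLeast-skip j (z ∷ τ) j∉ with j ≤? z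
... | yes j≤z rewrite filter-accept (j ≤?_) {xs = τ} j≤z
                    | filter-accept (suc j ≤?_) {xs = τ} (≤∧≢⇒< j≤z (j∉ ∘ here)) =
  cong (z ∷_) (atLeast-skip j τ (j∉ ∘ there))
... | no j≰z  rewrite filter-reject (j ≤?_) {xs = τ} j≰z
                    | filter-reject (suc j ≤?_) {xs = τ} (j≰z ∘ <⇒≤) =
  atLeast-skip j τ (j∉ ∘ there)

-- Reading τ from the largest letter down, the letter j is inserted into the word of larger
-- letters right after the code j τ letters that precede it.
atLeast-insert : ∀ {j τ} → Unique τ → j ∈ τ →
  atLeast j τ ≡ insert (code j τ) j (atLeast (suc j) τ) × code j τ ≤ length (atLeast (suc j) τ)
atLeast-insert {j} {z ∷ τ} (z∉τ ∷ uτ) j∈ with z ≟ j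
... | yes refl rewrite code-here z τ | filter-accept (z ≤?_) {xs = τ} ≤-refl
                     | filter-reject (suc z ≤?_) {xs = τ} (<-irrefl refl) =
  cong (z ∷_) (atLeast-skip z τ (UniqueP.Unique[x∷xs]⇒x∉xs (z∉τ ∷ uτ))) , z≤n
... | no z≢j with j <? z | atLeast-insert uτ (∈-∷⁻ j∈ (z≢j ∘ sym))
...   | yes j<z | eq , c≤ rewrite code-there-> τ j<z | filter-accept (j ≤?_) {xs = τ} (<⇒≤ j<z)
                                | filter-accept (suc j ≤?_) {xs = τ} j<z =
  cong (z ∷_) eq , s≤s c≤
...   | no j≮z  | eq , c≤ rewrite code-there-≯ τ j≮z z≢j
                                | filter-reject (j ≤?_) {xs = τ} (λ j≤z → j≮z (≤∧≢⇒< j≤z (z≢j ∘ sym)))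
                                | filter-reject (suc j ≤?_) {xs = τ} j≮z =
  eq , c≤

posOf-atLeast : ∀ {j τ} → Unique τ → j ∈ τ → posOf j (atLeast j τ) ≡ suc (code j τ)
posOf-atLeast {j} {τ} uτ j∈ with eq , c≤ ← atLeast-insert uτ j∈ =
  trans (cong (posOf j) eq) (posOf-insert-self (∉-atLeast-suc j τ) c≤)

decode : ℕ → List ℕ → List ℕ
decode i []       = []
decode i (c ∷ cs) = insert c i (decode (suc i) cs)

decode-↭ : ∀ i cs → decode i cs ↭ interval i (length cs)
decode-↭ i []       = ↭-refl
decode-↭ i (c ∷ cs) = ↭-trans (insert-↭ c i (decode (suc i) cs)) (↭-prep i (decode-↭ (suc i) cs))

length-decode : ∀ i cs → length (decode i cs) ≡ length cs
length-decode i cs = trans (↭P.↭-length (decode-↭ i cs)) (length-interval i (length cs))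

decode-isPermutation : ∀ {n w} → length w ≡ n → IsPermutation n (decode 1 w)
decode-isPermutation {n} {w} len = covering⇒IsPermutation (trans (length-decode 1 w) len) bnd cov
  where
  bnd : ∀ {x} → x ∈ decode 1 w → 0 < x × x ≤ n
  bnd x∈ = let 0<x , x<1+len = ∈-interval⁻ (↭P.∈-resp-↭ (decode-↭ 1 w) x∈)
           in 0<x , subst (_ ≤_) len (≤-pred x<1+len)
  cov : ∀ {x} → 0 < x → x ≤ n → x ∈ decode 1 w
  cov 0<x x≤n = ↭P.∈-resp-↭ (↭-sym (decode-↭ 1 w)) (∈-interval⁺ 0<x (s≤s (subst (_ ≤_) (sym len) x≤n)))

module _ {n σ} (p : IsPermutation n σ) where

  atLeast-beyond : ∀ {j} → n < j → atLeast j σ ≡ []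
  atLeast-beyond n<j = filter-none (_ ≤?_) (All.tabulate (λ x∈ j≤x →
    <-irrefl refl (<-≤-trans n<j (≤-trans j≤x (proj₂ (bounded p x∈))))))

  atLeast≡decode : ∀ k {j} → 0 < j → j + k ≡ suc n →
    atLeast j σ ≡ decode j (map (λ i → code i σ) (interval j k))
  atLeast≡decode zero {j} _ j+0≡ = atLeast-beyond (≤-reflexive (sym (trans (sym (+-identityʳ j)) j+0≡)))
  atLeast≡decode (suc k) {j} 0<j j+1+k≡ = trans (proj₁ (atLeast-insert (unique p) (complete p 0<j j≤n)))
    (cong (insert (code j σ) j) (atLeast≡decode k (s≤s z≤n) (trans (sym (+-suc j k)) j+1+k≡)))
    where
    j≤n : j ≤ n
    j≤n = ≤-pred (subst (j <_) j+1+k≡ (m<m+n j (s≤s z≤n)))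

  decode-Ic : decode 1 (Ic σ) ≡ σ
  decode-Ic = begin
    decode 1 (Ic σ)                                ≡⟨ cong (decode 1) (Ic≡map-code σ (length≡ p)) ⟩
    decode 1 (map (λ i → code i σ) (interval 1 n)) ≡⟨ sym (atLeast≡decode n (s≤s z≤n) refl) ⟩
    atLeast 1 σ                                    ≡⟨ filter-all (1 ≤?_) (All.tabulate (proj₁ ∘ bounded p)) ⟩
    σ                                              ∎
    where open ≡-Reasoning

  code-bound : ∀ {j} → 0 < j → j ≤ n → code j σ ≤ n ∸ j
  code-bound {j} 0<j j≤n = begin
    code j σ                        ≤⟨ proj₂ (atLeast-insert (unique p) (complete p 0<j j≤n)) ⟩
    length (atLeast (suc j) σ)      ≤⟨ Unique-⊆⇒length-≤ (UniqueP.filter⁺ (suc j ≤?_) (unique p)) ≥j⊆interval ⟩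
    length (interval (suc j) (n ∸ j)) ≡⟨ length-interval (suc j) (n ∸ j) ⟩
    n ∸ j                           ∎
    where
    open ≤-Reasoning
    ≥j⊆interval : ∀ {x} → x ∈ atLeast (suc j) σ → x ∈ interval (suc j) (n ∸ j)
    ≥j⊆interval x∈ = let x∈σ , j<x = ∈-filter⁻ (suc j ≤?_) {xs = σ} x∈
      in ∈-interval⁺ j<x (s≤s (subst (_ ≤_) (sym (m+[n∸m]≡n j≤n)) (proj₂ (bounded p x∈σ))))

Ic-injective : ∀ {n σ σ′} → IsPermutation n σ → IsPermutation n σ′ → Ic σ ≡ Ic σ′ → σ ≡ σ′
Ic-injective p p′ eq = trans (sym (decode-Ic p)) (trans (cong (decode 1) eq) (decode-Ic p′))

BoundedCode : List ℕ → Set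
BoundedCode []       = ⊤
BoundedCode (c ∷ cs) = c ≤ length cs × BoundedCode cs

map-code-decode : ∀ i cs → BoundedCode cs → map (λ j → code j (decode i cs)) (interval i (length cs)) ≡ cs
map-code-decode i []       _              = refl
map-code-decode i (c ∷ cs) (c≤ , bounded) = cong₂ _∷_
  (code-insert-self (λ x∈ → proj₁ (∈-interval⁻ (↭P.∈-resp-↭ (decode-↭ (suc i) cs) x∈)))
                    (subst (c ≤_) (sym (length-decode (suc i) cs)) c≤))
  (trans (map-cong-local (All.tabulate (λ j∈ → code-insert-other c (decode (suc i) cs) (proj₁ (∈-interval⁻ j∈)))))
         (map-code-decode (suc i) cs bounded))

boundedCode-at : ∀ w → (∀ j → 0 < j → j ≤ length w → at w j ≤ length w ∸ j) → BoundedCode w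
boundedCode-at []       _     = tt
boundedCode-at (c ∷ cs) bound = bound 1 (s≤s z≤n) (s≤s z≤n) , boundedCode-at cs (λ j 0<j j≤ →
  subst (_≤ length cs ∸ j) (at-∷ c cs 0<j) (bound (suc j) (s≤s z≤n) (s≤s j≤)))

Ic-decode : ∀ {n w} → length w ≡ n → (∀ j → 0 < j → j ≤ n → at w j ≤ n ∸ j) → Ic (decode 1 w) ≡ w
Ic-decode {w = w} refl bound =
  trans (Ic≡map-code (decode 1 w) (length-decode 1 w)) (map-code-decode 1 w (boundedCode-at w bound))

-- Both letters sit in atLeast j τ = insert (code j τ) j (insert (code (suc j) τ) (suc j) _),
-- where j lands in front of suc j exactly when its insertion position is not larger.
module _ {n τ j} (p : IsPermutation n τ) (0<j : 0 < j) (j<n : j < n) where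

  private
    c c′ : ℕ
    c  = code j τ
    c′ = code (suc j) τ

    j∈τ : j ∈ τ
    j∈τ = complete p 0<j (<⇒≤ j<n)

    1+j∈τ : suc j ∈ τ
    1+j∈τ = complete p (s≤s z≤n) j<n

    1+j∈atLeast : suc j ∈ atLeast (suc j) τ
    1+j∈atLeast = ∈-filter⁺ (suc j ≤?_) 1+j∈τ ≤-refl

    posOf-j : posOf j (atLeast j τ) ≡ suc c
    posOf-j = posOf-atLeast (unique p) j∈τ

    posOf-1+j : posOf (suc j) (atLeast (suc j) τ) ≡ suc c′
    posOf-1+j = posOf-atLeast (unique p) 1+j∈τ

    posOf-1+j-after-j : posOf (suc j) (atLeast j τ) ≡ posOf (suc j) (insert c j (atLeast (suc j) τ))
    posOf-1+j-after-j = cong (posOf (suc j)) (proj₁ (atLeast-insert (unique p) j∈τ))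

    1+j≢j : suc j ≢ j
    1+j≢j = >⇒≢ (n<1+n j)

  code-≤⇒precedes : c ≤ c′ → Precedes τ j (suc j)
  code-≤⇒precedes c≤c′ = precedes-filter⁻ (j ≤?_) j∈τ 1+j∈τ ≤-refl (n≤1+n j) (precedes (begin-strict
    posOf j (atLeast j τ)                          ≡⟨ posOf-j ⟩
    suc c                                          <⟨ s≤s (s≤s c≤c′) ⟩
    suc (suc c′)                                   ≡⟨ cong suc (sym posOf-1+j) ⟩
    suc (posOf (suc j) (atLeast (suc j) τ))        ≡⟨ sym (posOf-insert-after 1+j≢j 1+j∈atLeast c<pos) ⟩
    posOf (suc j) (insert c j (atLeast (suc j) τ)) ≡⟨ sym posOf-1+j-after-j ⟩
    posOf (suc j) (atLeast j τ)                    ∎))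
    where
    open ≤-Reasoning
    c<pos : c < posOf (suc j) (atLeast (suc j) τ)
    c<pos = subst (c <_) (sym posOf-1+j) (s≤s c≤c′)

  precedes⇒code-≤ : Precedes τ j (suc j) → c ≤ c′
  precedes⇒code-≤ j≺1+j with c ≤? c′
  ... | yes c≤c′ = c≤c′
  ... | no c≰c′  = ⊥-elim (<-asym j≺1+j′ (begin-strict
    posOf (suc j) (atLeast j τ)                    ≡⟨ posOf-1+j-after-j ⟩
    posOf (suc j) (insert c j (atLeast (suc j) τ)) ≡⟨ posOf-insert-before 1+j≢j 1+j∈atLeast pos≤c ⟩
    posOf (suc j) (atLeast (suc j) τ)              ≡⟨ posOf-1+j ⟩
    suc c′                                         <⟨ s≤s c′<c ⟩
    suc c                                          ≡⟨ sym posOf-j ⟩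
    posOf j (atLeast j τ)                          ∎))
    where
    open ≤-Reasoning
    c′<c : c′ < c
    c′<c = ≰⇒> c≰c′
    pos≤c : posOf (suc j) (atLeast (suc j) τ) ≤ c
    pos≤c = subst (_≤ c) (sym posOf-1+j) c′<c
    j≺1+j′ : posOf j (atLeast j τ) < posOf (suc j) (atLeast j τ)
    j≺1+j′ = posOf-< (precedes-filter⁺ (j ≤?_) j∈τ 1+j∈τ ≤-refl (n≤1+n j) j≺1+j)

record Admissible (I w : List ℕ) : Set where
  field
    length≡sum      : length w ≡ sum I
    ascendOffCuts   : ∀ j → NonCutFrom 0 I j → at w j ≤ at w (suc j)
    boundedBySuffix : ∀ j → 0 < j → j ≤ sum I → at w j ≤ sum I ∸ j
open Admissible

module _ (u v r : List ℕ) where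

  private
    i : ℕ
    i = length u
    m : ℕ
    m = sum r
    at-++-suc : ∀ k → at (u ++ v) (suc (i + k)) ≡ at v (suc k)
    at-++-suc k = trans (cong (at (u ++ v)) (sym (+-suc i k))) (at-++ʳ u v (s≤s z≤n))

  admissible-++⁺ : Linked _≤_ u → All (_≤ m) u → Admissible r v → Admissible (i ∷ r) (u ++ v)
  admissible-++⁺ linked u≤m adm = record
    { length≡sum      = trans (length-++ u) (cong (i +_) (length≡sum adm))
    ; ascendOffCuts   = ascend
    ; boundedBySuffix = bound
    }
    where
    ascend : ∀ j → NonCutFrom 0 (i ∷ r) j → at (u ++ v) j ≤ at (u ++ v) (suc j)
    ascend j nonCut@(0<j , _) with offset i j
    ... | before j<i  = subst₂ _≤_ (sym (at-++ˡ u v 0<j (<⇒≤ j<i))) (sym (at-++ˡ u v (s≤s z≤n) j<i))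
                          (Linked-at⁻ u linked j 0<j j<i)
    ... | pivot       = ⊥-elim (nonCut-∷-at i r nonCut)
    ... | after k 0<k = subst₂ _≤_ (sym (at-++ʳ u v 0<k)) (sym (at-++-suc k))
                          (ascendOffCuts adm k (nonCut-∷-beyond⁻ i r 0<k nonCut))
    bound-u : ∀ {j} → 0 < j → j ≤ i → at (u ++ v) j ≤ (i + m) ∸ j
    bound-u {j} 0<j j≤i = begin
      at (u ++ v) j ≡⟨ at-++ˡ u v 0<j j≤i ⟩
      at u j        ≤⟨ All-at⁻ u u≤m j 0<j j≤i ⟩
      m             ≡⟨ sym (m+n∸m≡n i m) ⟩
      (i + m) ∸ i   ≤⟨ ∸-monoʳ-≤ (i + m) j≤i ⟩
      (i + m) ∸ j   ∎
      where open ≤-Reasoning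
    bound : ∀ j → 0 < j → j ≤ i + m → at (u ++ v) j ≤ (i + m) ∸ j
    bound j 0<j j≤ with offset i j
    ... | before j<i  = bound-u 0<j (<⇒≤ j<i)
    ... | pivot       = bound-u 0<j ≤-refl
    ... | after k 0<k = subst₂ _≤_ (sym (at-++ʳ u v 0<k)) (sym ([m+n]∸[m+o]≡n∸o i m k))
                          (boundedBySuffix adm k 0<k (+-cancelˡ-≤ i k m j≤))

  admissible-++⁻ : Admissible (i ∷ r) (u ++ v) → Linked _≤_ u × All (_≤ m) u × Admissible r v
  admissible-++⁻ adm = linked , All-at⁺ u bound-u , record
    { length≡sum      = +-cancelˡ-≡ i (length v) m (trans (sym (length-++ u)) (length≡sum adm))
    ; ascendOffCuts   = λ j nonCut → subst₂ _≤_ (at-++ʳ u v (proj₁ nonCut)) (at-++-suc j)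
                          (ascendOffCuts adm (i + j) (nonCut-∷-beyond⁺ i r nonCut))
    ; boundedBySuffix = λ j 0<j j≤m → subst₂ _≤_ (at-++ʳ u v 0<j) ([m+n]∸[m+o]≡n∸o i m j)
                          (boundedBySuffix adm (i + j) (<-≤-trans 0<j (m≤n+m j i)) (+-monoʳ-≤ i j≤m))
    }
    where
    linked : Linked _≤_ u
    linked = Linked-at⁺ u (λ j 0<j j<i →
      subst₂ _≤_ (at-++ˡ u v 0<j (<⇒≤ j<i)) (at-++ˡ u v (s≤s z≤n) j<i)
                 (ascendOffCuts adm j (nonCut-∷-inside i r 0<j j<i)))
    bound-u : ∀ j → 0 < j → j ≤ i → at u j ≤ m
    bound-u j 0<j j≤i = begin
      at u j            ≤⟨ Linked-at-monotone u linked 0<j j≤i ≤-refl ⟩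
      at u i            ≡⟨ sym (at-++ˡ u v 0<i ≤-refl) ⟩
      at (u ++ v) i     ≤⟨ boundedBySuffix adm i 0<i (m≤m+n i m) ⟩
      (i + m) ∸ i       ≡⟨ m+n∸m≡n i m ⟩
      m                 ∎
      where
      open ≤-Reasoning
      0<i : 0 < i
      0<i = <-≤-trans 0<j j≤i

∈-rhsProd⁻ : ∀ I {w} → w ∈ rhsProd I → Admissible I w
∈-rhsProd⁻ [] (here refl) = record
  { length≡sum      = refl
  ; ascendOffCuts   = λ { _ (_ , () , _) }
  ; boundedBySuffix = λ _ 0<j j≤0 → ⊥-elim (<-irrefl refl (<-≤-trans 0<j j≤0))
  }
∈-rhsProd⁻ (i ∷ r) w∈ with u , v , u∈ , v∈ , refl ← ∈-⊗⁻ (S i (sum r)) (rhsProd r) w∈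
  with ∈-S⁻ {i} {sum r} u∈
... | refl , linked , u≤m = admissible-++⁺ u v r linked u≤m (∈-rhsProd⁻ r v∈)

∈-rhsProd⁺ : ∀ I {w} → Admissible I w → w ∈ rhsProd I
∈-rhsProd⁺ []      {[]} _   = here refl
∈-rhsProd⁺ (i ∷ r) {w}  adm with splitAt-length i w (subst (i ≤_) (sym (length≡sum adm)) (m≤m+n i (sum r)))
... | u , v , refl , refl with linked , u≤m , adm-v ← admissible-++⁻ u v r adm =
  ∈-⊗⁺ (∈-S⁺ {m = sum r} refl linked u≤m) (∈-rhsProd⁺ r adm-v)

unique-rhsProd : ∀ I → Unique (rhsProd I)
unique-rhsProd []      = [] ∷ []
unique-rhsProd (i ∷ r) = unique-⊗ (All.tabulate (proj₁ ∘ ∈-S⁻ {i} {sum r}))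
  (UniqueP.filter⁺ (linked? _≤?_) (unique-words i (upTo (suc (sum r))) (UniqueP.upTo⁺ (suc (sum r)))))
  (unique-rhsProd r)

module _ {I τ} (p : IsPermutation (sum I) τ) where

  private
    n : ℕ
    n = sum I
    Icⱼ : ∀ {j} → 0 < j → j ≤ n → at (Ic τ) j ≡ code j τ
    Icⱼ = at-Ic τ (length≡ p)

  InShuffle⇒Ic-admissible : InShuffle I τ → Admissible I (Ic τ)
  InShuffle⇒Ic-admissible sh = record
    { length≡sum      = length-Ic τ (length≡ p)
    ; ascendOffCuts   = λ j nonCut@(0<j , j<n , _) → subst₂ _≤_ (sym (Icⱼ 0<j (<⇒≤ j<n))) (sym (Icⱼ (s≤s z≤n) j<n))
                          (precedes⇒code-≤ p 0<j j<n (InShuffle⇒OrderedOffCuts p sh j nonCut))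
    ; boundedBySuffix = λ j 0<j j≤n → subst (_≤ n ∸ j) (sym (Icⱼ 0<j j≤n)) (code-bound p 0<j j≤n)
    }

  Ic-admissible⇒InShuffle : Admissible I (Ic τ) → InShuffle I τ
  Ic-admissible⇒InShuffle adm = OrderedOffCuts⇒InShuffle p λ j nonCut@(0<j , j<n , _) →
    code-≤⇒precedes p 0<j j<n (subst₂ _≤_ (Icⱼ 0<j (<⇒≤ j<n)) (Icⱼ (s≤s z≤n) j<n) (ascendOffCuts adm j nonCut))

Ic-shuffles↭rhsProd : ∀ I → map Ic (shuffles I) ↭ rhsProd I
Ic-shuffles↭rhsProd I = unique∧set⇒↭ (map⁺-injectiveOn Ic Ic-injectiveOn (unique-filter-Sym n (inShuffle? I)))
  (unique-rhsProd I) shuffle⇒rhs rhs⇒shuffle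
  where
  n : ℕ
  n = sum I
  Ic-injectiveOn : ∀ {σ σ′} → σ ∈ shuffles I → σ′ ∈ shuffles I → Ic σ ≡ Ic σ′ → σ ≡ σ′
  Ic-injectiveOn σ∈ σ′∈ = Ic-injective (proj₁ (∈-filter-Sym⁻ n (inShuffle? I) σ∈))
                                       (proj₁ (∈-filter-Sym⁻ n (inShuffle? I) σ′∈))
  shuffle⇒rhs : ∀ {w} → w ∈ map Ic (shuffles I) → w ∈ rhsProd I
  shuffle⇒rhs w∈ with τ , τ∈ , refl ← ∈-map⁻ Ic w∈
    with p , sh ← ∈-filter-Sym⁻ n (inShuffle? I) τ∈ =
    ∈-rhsProd⁺ I (InShuffle⇒Ic-admissible p sh)
  rhs⇒shuffle : ∀ {w} → w ∈ rhsProd I → w ∈ map Ic (shuffles I)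
  rhs⇒shuffle {w} w∈ = subst (_∈ _) Ic-decode≡w (∈-map⁺ Ic (∈-filter-Sym⁺ n (inShuffle? I) p
    (Ic-admissible⇒InShuffle p (subst (Admissible I) (sym Ic-decode≡w) adm))))
    where
    adm : Admissible I w
    adm = ∈-rhsProd⁻ I w∈
    p : IsPermutation n (decode 1 w)
    p = decode-isPermutation {w = w} (length≡sum adm)
    Ic-decode≡w : Ic (decode 1 w) ≡ w
    Ic-decode≡w = Ic-decode (length≡sum adm) (boundedBySuffix adm)

mainTheorem4 : (I : List ℕ) → All (0 <_) I →
    (map (λ σ → Ic (inv σ)) (filter (inD≤? I) (Sym (sum I)))
      ↭ map Ic (filter (inShuffle? I) (Sym (sum I))))
    × (map Ic (filter (inShuffle? I) (Sym (sum I))) ↭ rhsProd I)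
mainTheorem4 I _ =
  subst (_↭ map Ic (shuffles I)) (sym (map-∘ (D≤ I))) (↭P.map⁺ Ic (inv-D≤↭shuffles I)) ,
  Ic-shuffles↭rhsProd I
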